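{- Let $n,\lambda,\mu$ be nonnegative integers. Then \[\sum_{k=0}^n \binom{n+\mu n}{k}\binom{n+\lambda n}{n-k} H_{\lambda n+k} = \binom{2n+\lambda n+\mu n}{n}\Big\{H_{\lambda n+n}+H_{\lambda n+\mu n+n}-H_{\lambda n+\mu n+2n}\Big\}.\]
   Context: $H_0=0$ and $H_m=\sum_{j=1}^m \frac{1}{j}$ for positive integers $m$ (classical harmonic numbers). -}

module Defs where

open import Data.Nat using (ℕ; zero; suc)
open import Data.Integer using (+_)
open import Data.Rational using (ℚ; _/_; _+_; 0ℚ)

H : ℕ → ℚ
H zero = 0ℚ
H (suc m) = H m + (+ 1) / suc m

sumTo : ℕ → (ℕ → ℚ) → ℚ
sumTo zero f = f 0
sumTo (suc n) f = sumTo n f + f (suc n)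

module Submission where

-- Replace n + μn by an arbitrary upper index a and λn by an arbitrary offset c: then
--   S(a,c,n) = Σₖ C(a,k) C(n+c,n−k) H(c+k)  and  T(a,c,n) = C(n+a+c,n) (H(n+c) + H(a+c) − H(n+a+c))
-- agree at n = 0 and at a = 0, and both satisfy F(a+1,c,m+1) = F(a,c,m+1) + F(a,c+1,m).
-- For S this is Pascal's rule on C(a+1,k); for T, Pascal's rule on C(N+1,m+1) (N = m+1+a+c)
-- leaves the terms C(N,m+1)/(a+c+1) and C(N+1,m+1)/(N+1) coming from H(a+c+1) and H(N+1),
-- which cancel by the absorption identity (N+1) C(N,m+1) = (a+c+1) C(N+1,m+1).

open import Defs
open import Data.Nat using (ℕ; _∸_; zero; suc)
import Data.Nat as N
import Data.Nat.Properties as ℕ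
import Data.Nat.Tactic.RingSolver as ℕ-Solver
open import Data.Nat.Combinatorics using (_C_; nCk+nC[k+1]≡[n+1]C[k+1])
open import Relation.Binary.PropositionalEquality
  using (_≡_; refl; sym; trans; cong; cong₂; module ≡-Reasoning)

module BinomialCoefficients where

  open Data.Nat using (_+_; _*_)
  open Data.Nat.Combinatorics using (nCk≡nC[n∸k]; nC1≡n)
  open ℕ-Solver using (solve-∀)
  open ≡-Reasoning

  [1+k]*[1+n]C[1+k]≡[1+n]*nCk : ∀ n k → suc k * (suc n C suc k) ≡ suc n * (n C k)
  [1+k]*[1+n]C[1+k]≡[1+n]*nCk zero    zero    = refl
  [1+k]*[1+n]C[1+k]≡[1+n]*nCk zero    (suc k) = ℕ.*-zeroʳ (suc (suc k))
  [1+k]*[1+n]C[1+k]≡[1+n]*nCk (suc n) zero    =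
    trans (ℕ.*-identityˡ _) (trans (nC1≡n (suc (suc n))) (sym (ℕ.*-identityʳ _)))
  [1+k]*[1+n]C[1+k]≡[1+n]*nCk (suc n) (suc k) = begin
    suc (suc k) * (suc (suc n) C suc (suc k))
      ≡⟨ cong (suc (suc k) *_) (nCk+nC[k+1]≡[n+1]C[k+1] (suc n) (suc k)) ⟨
    suc (suc k) * (b + b′)
      ≡⟨ split (suc k) b b′ ⟩
    b + suc k * b + suc (suc k) * b′
      ≡⟨ cong₂ (λ x y → b + x + y) ([1+k]*[1+n]C[1+k]≡[1+n]*nCk n k) ([1+k]*[1+n]C[1+k]≡[1+n]*nCk n (suc k)) ⟩
    b + suc n * a + suc n * a′
      ≡⟨ cong (λ x → x + suc n * a + suc n * a′) (nCk+nC[k+1]≡[n+1]C[k+1] n k) ⟨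
    a + a′ + suc n * a + suc n * a′
      ≡⟨ merge n a a′ ⟩
    suc (suc n) * (a + a′)
      ≡⟨ cong (suc (suc n) *_) (nCk+nC[k+1]≡[n+1]C[k+1] n k) ⟩
    suc (suc n) * (suc n C suc k)
      ∎
    where
    a a′ b b′ : ℕ
    a  = n C k
    a′ = n C suc k
    b  = suc n C suc k
    b′ = suc n C suc (suc k)
    split : ∀ k x y → suc k * (x + y) ≡ x + k * x + suc k * y
    split = solve-∀
    merge : ∀ n x y → x + y + suc n * x + suc n * y ≡ suc (suc n) * (x + y)
    merge = solve-∀

  [m+p]Cm≡[p+m]Cp : ∀ m p → (m + p) C m ≡ (p + m) C p
  [m+p]Cm≡[p+m]Cp m p =
    trans (nCk≡nC[n∸k] (ℕ.m≤m+n m p)) (cong₂ _C_ (ℕ.+-comm m p) (ℕ.m+n∸m≡n m p))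

  [1+m]*[1+m+p]C[1+m]≡[1+p]*[1+m+p]Cm : ∀ m p → suc m * ((suc m + p) C suc m) ≡ suc p * ((suc m + p) C m)
  [1+m]*[1+m+p]C[1+m]≡[1+p]*[1+m+p]Cm m p = begin
    suc m * ((suc m + p) C suc m)  ≡⟨ [1+k]*[1+n]C[1+k]≡[1+n]*nCk (m + p) m ⟩
    suc (m + p) * ((m + p) C m)    ≡⟨ cong₂ (λ x y → suc x * y) (ℕ.+-comm m p) ([m+p]Cm≡[p+m]Cp m p) ⟩
    suc (p + m) * ((p + m) C p)    ≡⟨ [1+k]*[1+n]C[1+k]≡[1+n]*nCk (p + m) p ⟨
    suc p * ((suc p + m) C suc p)  ≡⟨ cong (suc p *_) ([m+p]Cm≡[p+m]Cp (suc p) m) ⟩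
    suc p * ((m + suc p) C m)      ≡⟨ cong (λ x → suc p * (x C m)) (ℕ.+-suc m p) ⟩
    suc p * ((suc m + p) C m)      ∎

  [2+m+p]*[1+m+p]C[1+m]≡[1+p]*[2+m+p]C[1+m] :
    ∀ m p → suc (suc m + p) * ((suc m + p) C suc m) ≡ suc p * (suc (suc m + p) C suc m)
  [2+m+p]*[1+m+p]C[1+m]≡[1+p]*[2+m+p]C[1+m] m p = begin
    suc (suc m + p) * X       ≡⟨ cong (_* X) (cong suc (ℕ.+-suc m p)) ⟨
    (suc m + suc p) * X       ≡⟨ ℕ.*-distribʳ-+ X (suc m) (suc p) ⟩
    suc m * X + suc p * X     ≡⟨ cong (_+ suc p * X) ([1+m]*[1+m+p]C[1+m]≡[1+p]*[1+m+p]Cm m p) ⟩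
    suc p * Y + suc p * X     ≡⟨ ℕ.*-distribˡ-+ (suc p) Y X ⟨
    suc p * (Y + X)           ≡⟨ cong (suc p *_) (nCk+nC[k+1]≡[n+1]C[k+1] (suc m + p) m) ⟩
    suc p * (suc (suc m + p) C suc m) ∎
    where
    X Y : ℕ
    X = (suc m + p) C suc m
    Y = (suc m + p) C m

open BinomialCoefficients

open import Data.Nat.Coprimality using (1-coprimeTo) renaming (sym to coprime-sym)
open import Data.Integer using (+_)
import Data.Integer as ℤ
import Data.Integer.Properties as ℤₚ
open import Data.Rational using (ℚ; _*_; _+_; _-_; _/_; mkℚ; toℚᵘ; 0ℚ; 1ℚ)
open import Data.Rational.Properties
  using (+-*-commutativeRing; _≟_; normalize-coprime; toℚᵘ-injective; toℚᵘ-homo-+; toℚᵘ-homo-*; *-inverseʳ; *-identityʳ; *-comm; +-assoc)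
open import Data.Rational.Unnormalised using (mkℚᵘ; *≡*; _≃_)
import Data.Rational.Unnormalised as ℚᵘ
import Data.Rational.Unnormalised.Properties as ℚᵘ
open import Tactic.RingSolver using (solve-∀)
open import Tactic.RingSolver.Core.AlmostCommutativeRing using (AlmostCommutativeRing; fromCommutativeRing)
open import Relation.Nullary.Decidable using (dec⇒maybe)
open import Level using (0ℓ)

ℚ-ring : AlmostCommutativeRing 0ℓ 0ℓ
ℚ-ring = fromCommutativeRing +-*-commutativeRing (λ x → dec⇒maybe (0ℚ ≟ x))

fromℕ : ℕ → ℚ
fromℕ n = + n / 1

fromℕ≡mkℚ : ∀ n → fromℕ n ≡ mkℚ (+ n) 0 (coprime-sym (1-coprimeTo n))
fromℕ≡mkℚ n = normalize-coprime (coprime-sym (1-coprimeTo n))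

toℚᵘ-fromℕ : ∀ n → toℚᵘ (fromℕ n) ≃ mkℚᵘ (+ n) 0
toℚᵘ-fromℕ n = ℚᵘ.≃-reflexive (cong toℚᵘ (fromℕ≡mkℚ n))

fromℕ-+ : ∀ m n → fromℕ (m N.+ n) ≡ fromℕ m + fromℕ n
fromℕ-+ m n = toℚᵘ-injective (begin
  toℚᵘ (fromℕ (m N.+ n))               ≈⟨ toℚᵘ-fromℕ (m N.+ n) ⟩
  mkℚᵘ (+ (m N.+ n)) 0                 ≈⟨ *≡* (trans (ℤₚ.*-identityʳ _) (trans (ℤₚ.pos-+ m n) (sym eq))) ⟩
  mkℚᵘ (+ m) 0 ℚᵘ.+ mkℚᵘ (+ n) 0      ≈⟨ ℚᵘ.+-cong (toℚᵘ-fromℕ m) (toℚᵘ-fromℕ n) ⟨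
  toℚᵘ (fromℕ m) ℚᵘ.+ toℚᵘ (fromℕ n)  ≈⟨ toℚᵘ-homo-+ (fromℕ m) (fromℕ n) ⟨
  toℚᵘ (fromℕ m + fromℕ n)             ∎)
  where
  open ℚᵘ.≃-Reasoning
  eq : (+ m ℤ.* + 1 ℤ.+ + n ℤ.* + 1) ℤ.* + 1 ≡ + m ℤ.+ + n
  eq = trans (ℤₚ.*-identityʳ _) (cong₂ ℤ._+_ (ℤₚ.*-identityʳ (+ m)) (ℤₚ.*-identityʳ (+ n)))

fromℕ-* : ∀ m n → fromℕ (m N.* n) ≡ fromℕ m * fromℕ n
fromℕ-* m n = toℚᵘ-injective (begin
  toℚᵘ (fromℕ (m N.* n))               ≈⟨ toℚᵘ-fromℕ (m N.* n) ⟩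
  mkℚᵘ (+ (m N.* n)) 0                 ≈⟨ *≡* (trans (ℤₚ.*-identityʳ _) (trans (ℤₚ.pos-* m n) (sym (ℤₚ.*-identityʳ _)))) ⟩
  mkℚᵘ (+ m) 0 ℚᵘ.* mkℚᵘ (+ n) 0      ≈⟨ ℚᵘ.*-cong (toℚᵘ-fromℕ m) (toℚᵘ-fromℕ n) ⟨
  toℚᵘ (fromℕ m) ℚᵘ.* toℚᵘ (fromℕ n)  ≈⟨ toℚᵘ-homo-* (fromℕ m) (fromℕ n) ⟨
  toℚᵘ (fromℕ m * fromℕ n)             ∎)
  where open ℚᵘ.≃-Reasoning

fromℕ[1+n]*1/[1+n]≡1 : ∀ n → fromℕ (suc n) * (+ 1 / suc n) ≡ 1ℚ
fromℕ[1+n]*1/[1+n]≡1 n =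
  trans (cong₂ _*_ (fromℕ≡mkℚ (suc n)) (normalize-coprime (1-coprimeTo (suc n))))
        (*-inverseʳ (mkℚ (+ suc n) 0 (coprime-sym (1-coprimeTo (suc n)))))

fromℕ-[1+n]C[1+k] : ∀ n k → fromℕ (suc n C suc k) ≡ fromℕ (n C k) + fromℕ (n C suc k)
fromℕ-[1+n]C[1+k] n k = trans (cong fromℕ (sym (nCk+nC[k+1]≡[n+1]C[k+1] n k))) (fromℕ-+ (n C k) (n C suc k))

[1+q]*x≡[1+p]*y⇒x/[1+p]≡y/[1+q] : ∀ {x y} p q →
  fromℕ (suc q) * x ≡ fromℕ (suc p) * y → x * (+ 1 / suc p) ≡ y * (+ 1 / suc q)
[1+q]*x≡[1+p]*y⇒x/[1+p]≡y/[1+q] {x} {y} p q Qx≡Py = begin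
  x * u              ≡⟨ *-identityʳ (x * u) ⟨
  x * u * 1ℚ         ≡⟨ cong (x * u *_) (fromℕ[1+n]*1/[1+n]≡1 q) ⟨
  x * u * (Q * v)    ≡⟨ rearrange x u Q v ⟩
  Q * x * (u * v)    ≡⟨ cong (_* (u * v)) Qx≡Py ⟩
  P * y * (u * v)    ≡⟨ cong (P * y *_) (*-comm u v) ⟩
  P * y * (v * u)    ≡⟨ rearrange y v P u ⟨
  y * v * (P * u)    ≡⟨ cong (y * v *_) (fromℕ[1+n]*1/[1+n]≡1 p) ⟩
  y * v * 1ℚ         ≡⟨ *-identityʳ (y * v) ⟩
  y * v              ∎
  where
  open ≡-Reasoning
  P Q u v : ℚ
  P = fromℕ (suc p)
  Q = fromℕ (suc q)
  u = + 1 / suc p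
  v = + 1 / suc q
  rearrange : ∀ a b c d → a * b * (c * d) ≡ c * a * (b * d)
  rearrange = solve-∀ ℚ-ring

sumTo-cong : ∀ n {f g : ℕ → ℚ} → (∀ k → f k ≡ g k) → sumTo n f ≡ sumTo n g
sumTo-cong zero    f≡g = f≡g 0
sumTo-cong (suc n) f≡g = cong₂ _+_ (sumTo-cong n f≡g) (f≡g (suc n))

sumTo-suc : ∀ n (f : ℕ → ℚ) → sumTo (suc n) f ≡ f 0 + sumTo n (λ k → f (suc k))
sumTo-suc zero    f = refl
sumTo-suc (suc n) f = trans (cong (_+ f (suc (suc n))) (sumTo-suc n f)) (+-assoc (f 0) _ _)

sumTo-distrib-+ : ∀ n (f g : ℕ → ℚ) → sumTo n (λ k → f k + g k) ≡ sumTo n f + sumTo n g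
sumTo-distrib-+ zero    f g = refl
sumTo-distrib-+ (suc n) f g =
  trans (cong (_+ (f (suc n) + g (suc n))) (sumTo-distrib-+ n f g))
        (+-interchange (sumTo n f) (sumTo n g) (f (suc n)) (g (suc n)))
  where
  +-interchange : ∀ a b c d → (a + b) + (c + d) ≡ (a + c) + (b + d)
  +-interchange = solve-∀ ℚ-ring

sumTo-≡0 : ∀ n {f : ℕ → ℚ} → (∀ k → f k ≡ 0ℚ) → sumTo n f ≡ 0ℚ
sumTo-≡0 zero    f≡0 = f≡0 0
sumTo-≡0 (suc n) f≡0 = cong₂ _+_ (sumTo-≡0 n f≡0) (f≡0 (suc n))

binomialHarmonicSum : (a c n : ℕ) → ℚ
binomialHarmonicSum a c n = sumTo n (λ k → fromℕ (a C k) * fromℕ ((n N.+ c) C (n ∸ k)) * H (c N.+ k))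

binomialHarmonicClosedForm : (a c n : ℕ) → ℚ
binomialHarmonicClosedForm a c n =
  fromℕ ((n N.+ (a N.+ c)) C n) * (H (n N.+ c) + H (a N.+ c) - H (n N.+ (a N.+ c)))

binomialHarmonic-cong : ∀ {K K′ x x′ y y′ z z′} k → K ≡ K′ → x ≡ x′ → y ≡ y′ → z ≡ z′ →
  fromℕ (K C k) * (H x + H y - H z) ≡ fromℕ (K′ C k) * (H x′ + H y′ - H z′)
binomialHarmonic-cong k refl refl refl refl = refl

binomialHarmonicSum-suc : ∀ a c m → binomialHarmonicSum (suc a) c (suc m)
  ≡ binomialHarmonicSum a c (suc m) + binomialHarmonicSum a (suc c) m
binomialHarmonicSum-suc a c m = begin
  binomialHarmonicSum (suc a) c (suc m)
    ≡⟨ sumTo-suc m _ ⟩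
  t₀ + sumTo m (λ j → fromℕ (suc a C suc j) * B j * h j)
    ≡⟨ cong (_+_ t₀) (sumTo-cong m pascal) ⟩
  t₀ + sumTo m (λ j → f j + g j)
    ≡⟨ cong (_+_ t₀) (sumTo-distrib-+ m f g) ⟩
  t₀ + (sumTo m f + sumTo m g)
    ≡⟨ +-assoc t₀ _ _ ⟨
  (t₀ + sumTo m f) + sumTo m g
    ≡⟨ cong₂ _+_ (sumTo-suc m _) (sumTo-cong m shift) ⟨
  binomialHarmonicSum a c (suc m) + binomialHarmonicSum a (suc c) m
    ∎
  where
  open ≡-Reasoning
  B h f g : ℕ → ℚ
  B j = fromℕ ((suc m N.+ c) C (m ∸ j))
  h j = H (c N.+ suc j)
  f j = fromℕ (a C suc j) * B j * h j
  g j = fromℕ (a C j) * B j * h j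
  t₀ : ℚ
  t₀ = fromℕ (a C 0) * fromℕ ((suc m N.+ c) C suc m) * H (c N.+ 0)
  distrib : ∀ x y b h → (x + y) * b * h ≡ y * b * h + x * b * h
  distrib = solve-∀ ℚ-ring
  pascal : ∀ j → fromℕ (suc a C suc j) * B j * h j ≡ f j + g j
  pascal j = trans (cong (λ x → x * B j * h j) (fromℕ-[1+n]C[1+k] a j)) (distrib (fromℕ (a C j)) (fromℕ (a C suc j)) (B j) (h j))
  shift : ∀ j → fromℕ (a C j) * fromℕ ((m N.+ suc c) C (m ∸ j)) * H (suc c N.+ j) ≡ g j
  shift j = cong₂ (λ K i → fromℕ (a C j) * fromℕ (K C (m ∸ j)) * H i) (ℕ.+-suc m c) (sym (ℕ.+-suc c j))

binomialHarmonicClosedForm-suc : ∀ a c m → binomialHarmonicClosedForm (suc a) c (suc m)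
  ≡ binomialHarmonicClosedForm a c (suc m) + binomialHarmonicClosedForm a (suc c) m
binomialHarmonicClosedForm-suc a c m = begin
  binomialHarmonicClosedForm (suc a) c (suc m)
    ≡⟨ cong (λ K → fromℕ (K C suc m) * (A + H (suc p) - H K)) (cong suc (ℕ.+-suc m p)) ⟩
  fromℕ (suc N C suc m) * (A + H (suc p) - H (suc N))
    ≡⟨ cong (λ x → x * (A + (B + u) - (D + v))) (fromℕ-[1+n]C[1+k] N m) ⟩
  (Y + X) * (A + (B + u) - (D + v))
    ≡⟨ split ⟩
  X * (A + B - D) + Y * (A + (B + u) - D)
    ≡⟨ cong (_+_ (X * (A + B - D))) (binomialHarmonic-cong m m+[a+1+c]≡N (ℕ.+-suc m c) (ℕ.+-suc a c) m+[a+1+c]≡N) ⟨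
  binomialHarmonicClosedForm a c (suc m) + binomialHarmonicClosedForm a (suc c) m
    ∎
  where
  open ≡-Reasoning
  p N : ℕ
  A B D u v X Y : ℚ
  p = a N.+ c
  N = suc m N.+ p
  A = H (suc m N.+ c)
  B = H p
  D = H N
  u = + 1 / suc p
  v = + 1 / suc N
  X = fromℕ (N C suc m)
  Y = fromℕ (N C m)
  m+[a+1+c]≡N : m N.+ (a N.+ suc c) ≡ N
  m+[a+1+c]≡N = trans (cong (m N.+_) (ℕ.+-suc a c)) (ℕ.+-suc m p)
  [1+N]*X≡[1+p]*[Y+X] : fromℕ (suc N) * X ≡ fromℕ (suc p) * (Y + X)
  [1+N]*X≡[1+p]*[Y+X] = begin
    fromℕ (suc N) * X                     ≡⟨ fromℕ-* (suc N) (N C suc m) ⟨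
    fromℕ (suc N N.* (N C suc m))         ≡⟨ cong fromℕ ([2+m+p]*[1+m+p]C[1+m]≡[1+p]*[2+m+p]C[1+m] m p) ⟩
    fromℕ (suc p N.* (suc N C suc m))     ≡⟨ fromℕ-* (suc p) (suc N C suc m) ⟩
    fromℕ (suc p) * fromℕ (suc N C suc m) ≡⟨ cong (fromℕ (suc p) *_) (fromℕ-[1+n]C[1+k] N m) ⟩
    fromℕ (suc p) * (Y + X)               ∎
  expand : ∀ X Y A B D u v → (Y + X) * (A + (B + u) - (D + v))
    ≡ X * (A + B - D) + Y * (A + (B + u) - D) + (X * u - (Y + X) * v)
  expand = solve-∀ ℚ-ring
  cancel : ∀ a w → a + (w - w) ≡ a
  cancel = solve-∀ ℚ-ring
  split : (Y + X) * (A + (B + u) - (D + v)) ≡ X * (A + B - D) + Y * (A + (B + u) - D)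
  split = begin
    (Y + X) * (A + (B + u) - (D + v))
      ≡⟨ expand X Y A B D u v ⟩
    X * (A + B - D) + Y * (A + (B + u) - D) + (X * u - (Y + X) * v)
      ≡⟨ cong (λ w → X * (A + B - D) + Y * (A + (B + u) - D) + (w - (Y + X) * v))
              ([1+q]*x≡[1+p]*y⇒x/[1+p]≡y/[1+q] p N [1+N]*X≡[1+p]*[Y+X]) ⟩
    X * (A + B - D) + Y * (A + (B + u) - D) + ((Y + X) * v - (Y + X) * v)
      ≡⟨ cancel _ ((Y + X) * v) ⟩
    X * (A + B - D) + Y * (A + (B + u) - D)
      ∎

binomialHarmonicSum≡closedForm : ∀ a c n → binomialHarmonicSum a c n ≡ binomialHarmonicClosedForm a c n
binomialHarmonicSum≡closedForm a c zero =
  trans (cong (λ i → 1ℚ * 1ℚ * H i) (ℕ.+-identityʳ c)) (unit (H c) (H (a N.+ c)))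
  where
  unit : ∀ h y → 1ℚ * 1ℚ * h ≡ 1ℚ * (h + y - y)
  unit = solve-∀ ℚ-ring
binomialHarmonicSum≡closedForm zero c (suc m) = begin
  binomialHarmonicSum zero c (suc m)
    ≡⟨ sumTo-suc m _ ⟩
  1ℚ * X * H (c N.+ 0) + sumTo m (λ j → 0ℚ * B j * H (c N.+ suc j))
    ≡⟨ cong₂ (λ i s → 1ℚ * X * H i + s) (ℕ.+-identityʳ c) (sumTo-≡0 m (λ j → 0*b*h≡0 (B j) (H (c N.+ suc j)))) ⟩
  1ℚ * X * H c + 0ℚ
    ≡⟨ unit X (H c) (H (suc m N.+ c)) ⟩
  binomialHarmonicClosedForm zero c (suc m)
    ∎
  where
  open ≡-Reasoning
  X : ℚ
  X = fromℕ ((suc m N.+ c) C suc m)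
  B : ℕ → ℚ
  B j = fromℕ ((suc m N.+ c) C (m ∸ j))
  0*b*h≡0 : ∀ b h → 0ℚ * b * h ≡ 0ℚ
  0*b*h≡0 = solve-∀ ℚ-ring
  unit : ∀ x h y → 1ℚ * x * h + 0ℚ ≡ x * (y + h - y)
  unit = solve-∀ ℚ-ring
binomialHarmonicSum≡closedForm (suc a) c (suc m) = begin
  binomialHarmonicSum (suc a) c (suc m)
    ≡⟨ binomialHarmonicSum-suc a c m ⟩
  binomialHarmonicSum a c (suc m) + binomialHarmonicSum a (suc c) m
    ≡⟨ cong₂ _+_ (binomialHarmonicSum≡closedForm a c (suc m)) (binomialHarmonicSum≡closedForm a (suc c) m) ⟩
  binomialHarmonicClosedForm a c (suc m) + binomialHarmonicClosedForm a (suc c) m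
    ≡⟨ binomialHarmonicClosedForm-suc a c m ⟨
  binomialHarmonicClosedForm (suc a) c (suc m)
    ∎
  where open ≡-Reasoning

theorem1 : (n λ' μ : ℕ) →
    sumTo n (λ k → ((+ ((n N.+ μ N.* n) C k)) / 1) * ((+ ((n N.+ λ' N.* n) C (n ∸ k))) / 1) * H (λ' N.* n N.+ k))
      ≡ ((+ ((2 N.* n N.+ λ' N.* n N.+ μ N.* n) C n)) / 1) * (H (λ' N.* n N.+ n) + H (λ' N.* n N.+ μ N.* n N.+ n) - H (λ' N.* n N.+ μ N.* n N.+ 2 N.* n))
theorem1 n λ' μ =
  trans (binomialHarmonicSum≡closedForm (n N.+ μ N.* n) (λ' N.* n) n)
        (binomialHarmonic-cong n (n+[n+mn+ln]≡2n+ln+mn n λ' μ) (ℕ.+-comm n (λ' N.* n)) (n+mn+ln≡ln+mn+n n λ' μ) (n+[n+mn+ln]≡ln+mn+2n n λ' μ))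
  where
  n+[n+mn+ln]≡2n+ln+mn : ∀ n l m → n N.+ ((n N.+ m N.* n) N.+ l N.* n) ≡ 2 N.* n N.+ l N.* n N.+ m N.* n
  n+[n+mn+ln]≡2n+ln+mn = ℕ-Solver.solve-∀
  n+mn+ln≡ln+mn+n : ∀ n l m → (n N.+ m N.* n) N.+ l N.* n ≡ l N.* n N.+ m N.* n N.+ n
  n+mn+ln≡ln+mn+n = ℕ-Solver.solve-∀
  n+[n+mn+ln]≡ln+mn+2n : ∀ n l m → n N.+ ((n N.+ m N.* n) N.+ l N.* n) ≡ l N.* n N.+ m N.* n N.+ 2 N.* n
  n+[n+mn+ln]≡ln+mn+2n = ℕ-Solver.solve-∀
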